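{- Let $n$ be an odd prime and let $\overrightarrow{a}=[S_1,S_2,\dots,S_{\frac{n-1}{2}}]$ be the staircase array. For every $k$ with $1\leqslant k\leqslant \frac{n-1}{2}$, with all computations in $\mathbb{Z}_n$: (a) for $1\leqslant p\leqslant q\leqslant 2n$, $$\sum_{a_g\in S_k^{p,q}} a_g=\begin{cases}\left(\left(\lfloor \tfrac q2\rfloor-\lfloor\tfrac{p-1}2\rfloor\right)(2k-1),\ \left(\lceil\tfrac q2\rceil-\lceil\tfrac{p-1}2\rceil\right)(2k-1)\right) & q\neq 2n,\\ \left(1-\lfloor\tfrac{p-1}2\rfloor(2k-1),\ -\lceil\tfrac{p-1}2\rceil(2k-1)\right) & q=2n;\end{cases}$$ (b) $\sum_{a_g\in S_k}a_g=(1,0)$; (c) $\sum_{a_g\in S_k^{p,q}}a_g\neq(0,0)$ for all $1\leqslant p\leqslant q\leqslant 2n$.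
   Context: For odd $n$, the staircase array is the array of elements of $\mathbb{Z}_n\times\mathbb{Z}_n$ obtained by concatenating the stretches $S_1,\dots,S_{(n-1)/2}$, where $S_k=[a_{k,1},a_{k,2},\dots,a_{k,2n}]$ has length $2n$ with $a_{k,g}=(0,2k-1)$ for odd $g$, $a_{k,g}=(2k-1,0)$ for even $g<2n$, and $a_{k,2n}=(2k,0)$; i.e. $S_k=[(0,2k-1),(2k-1,0),\dots,(0,2k-1),(2k,0)]$. For $1\leqslant p\leqslant q\leqslant 2n$, the partial stretch is $S_k^{p,q}=[a_{k,p},a_{k,p+1},\dots,a_{k,q}]$. -}

module Defs where

open import Data.Bool using (Bool; if_then_else_)
open import Data.Nat as ℕ using (ℕ; suc; _∸_; _/_; _%_; _≡ᵇ_)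
open import Data.Integer as ℤ using (ℤ; +_; 0ℤ; 1ℤ)
open import Data.Integer.Divisibility using (_∣_)
open import Data.List using (List; []; _∷_; map; foldr; upTo; concat)
open import Data.Product using (_×_; _,_; proj₁; proj₂)
open import Relation.Nullary using (¬_)

-- Elements of ℤ_n × ℤ_n are represented by integer pairs; equality in
-- ℤ_n × ℤ_n is componentwise congruence modulo n.
Pair : Set
Pair = ℤ × ℤ

_≡_[mod_] : ℤ → ℤ → ℕ → Set
x ≡ y [mod n ] = (+ n) ∣ (x ℤ.- y)

_≈_[mod_] : Pair → Pair → ℕ → Set
u ≈ v [mod n ] = (proj₁ u ≡ proj₁ v [mod n ]) × (proj₂ u ≡ proj₂ v [mod n ])

_+ᵖ_ : Pair → Pair → Pair
(a , b) +ᵖ (c , d) = (a ℤ.+ c , b ℤ.+ d)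

sumᵖ : List Pair → Pair
sumᵖ = foldr _+ᵖ_ (0ℤ , 0ℤ)

odd2k-1 : ℕ → ℤ
odd2k-1 k = + (2 ℕ.* k) ℤ.- 1ℤ

a : (n k g : ℕ) → Pair
a n k g =
  if g ≡ᵇ 2 ℕ.* n then (+ (2 ℕ.* k) , 0ℤ)
  else if g % 2 ≡ᵇ 1 then (0ℤ , odd2k-1 k)
  else (odd2k-1 k , 0ℤ)

range : ℕ → ℕ → List ℕ
range p q = map (λ i → p ℕ.+ i) (upTo (suc q ∸ p))

partialStretch : (n k p q : ℕ) → List Pair
partialStretch n k p q = map (a n k) (range p q)

stretch : (n k : ℕ) → List Pair
stretch n k = partialStretch n k 1 (2 ℕ.* n)

staircase : ℕ → List Pair
staircase n = concat (map (λ i → stretch n (suc i)) (upTo ((n ∸ 1) / 2)))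

⌊_/2⌋ : ℕ → ℕ
⌊ m /2⌋ = m / 2

⌈_/2⌉ : ℕ → ℕ
⌈ m /2⌉ = suc m / 2

formula : (n k p q : ℕ) → Pair
formula n k p q =
  if q ≡ᵇ 2 ℕ.* n
  then ( 1ℤ ℤ.- (+ ⌊ p ∸ 1 /2⌋) ℤ.* odd2k-1 k
       , ℤ.- ((+ ⌈ p ∸ 1 /2⌉) ℤ.* odd2k-1 k) )
  else ( (+ ⌊ q /2⌋ ℤ.- + ⌊ p ∸ 1 /2⌋) ℤ.* odd2k-1 k
       , (+ ⌈ q /2⌉ ℤ.- + ⌈ p ∸ 1 /2⌉) ℤ.* odd2k-1 k )

{-# OPTIONS --safe #-}
module Submission where

-- Every partial sum is a difference of prefix sums P(q) = a_1 + ⋯ + a_q.  Below the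
-- last position two consecutive entries add up to (2k-1, 2k-1), whence
-- P(q) = (⌊q/2⌋(2k-1), ⌈q/2⌉(2k-1)) for q < 2n, while the final entry (2k, 0) gives
-- P(2n) = (1 + n(2k-1), n(2k-1)) ≡ (1, 0).  For (c), n is prime and divides neither
-- 2k-1 nor 2k.  If q < 2n, a vanishing first coordinate forces ⌊q/2⌋ = ⌊(p-1)/2⌋,
-- hence q = p, and then the second coordinate is 2k-1.  If q = 2n, a vanishing second
-- coordinate forces ⌈(p-1)/2⌉ ∈ {0, n}, i.e. p = 1 or p = 2n, and the first
-- coordinate is then 1 or ≡ 2k.

open import Defs
open import Data.Bool using (true; false; if_then_else_)
open import Data.Nat using (ℕ; zero; suc; _+_; _*_; _∸_; _/_; _%_; _≡ᵇ_; _≤_; _<_; _≟_; z≤n; s≤s)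
import Data.Nat.Properties as ℕₚ
open import Data.Nat.DivMod using (m*n/n≡m; m/n*n≤m; /-monoˡ-≤; m<n*o⇒m/o<n; +-distrib-/-∣ˡ)
import Data.Nat.Divisibility as ℕ
open import Data.Nat.Primality using (Prime; euclidsLemma; ¬prime[1])
open import Data.Integer as ℤ using (ℤ; +_; 0ℤ; 1ℤ; ∣_∣)
import Data.Integer.Properties as ℤₚ
open import Data.Integer.Divisibility using (_∣_)
import Data.Integer.Divisibility.Signed as Signed
open import Data.Integer.Tactic.RingSolver using (solve-∀)
open import Data.List using (map; applyUpTo)
open import Data.List.Properties using (map-applyUpTo)
open import Data.Product using (_×_; _,_)
open import Data.Sum using (inj₁; inj₂)
open import Relation.Binary.PropositionalEquality
  using (_≡_; _≢_; refl; sym; trans; cong; cong₂; subst; module ≡-Reasoning)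
open import Relation.Nullary using (¬_; yes; no; contradiction)

≢⇒≡ᵇ≡false : ∀ {m n} → m ≢ n → (m ≡ᵇ n) ≡ false
≢⇒≡ᵇ≡false {m} {n} m≢n with m ≡ᵇ n | ℕₚ.≡ᵇ⇒≡ m n
... | false | _    = refl
... | true  | ≡ᵇ⇒≡ = contradiction (≡ᵇ⇒≡ _) m≢n

≡ᵇ-refl : ∀ m → (m ≡ᵇ m) ≡ true
≡ᵇ-refl zero    = refl
≡ᵇ-refl (suc m) = ≡ᵇ-refl m

[2+m]/2≡1+m/2 : ∀ m → suc (suc m) / 2 ≡ suc (m / 2)
[2+m]/2≡1+m/2 m = +-distrib-/-∣ˡ {2} m ℕ.∣-refl

[1+m*2]/2≡m : ∀ m → suc (m * 2) / 2 ≡ m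
[1+m*2]/2≡m zero    = refl
[1+m*2]/2≡m (suc m) = trans ([2+m]/2≡1+m/2 (suc (m * 2))) (cong suc ([1+m*2]/2≡m m))

m<q∧q/2≡m/2⇒q≡1+m : ∀ {m q} → m < q → q / 2 ≡ m / 2 → q ≡ suc m
m<q∧q/2≡m/2⇒q≡1+m {m} {q} m<q q/2≡m/2 = ℕₚ.≤-antisym (ℕₚ.≮⇒≥ 1+m≮q) m<q
  where
  1+m≮q : ¬ suc m < q
  1+m≮q 1+m<q = ℕₚ.1+n≰n (begin
    suc (m / 2)       ≡⟨ [2+m]/2≡1+m/2 m ⟨
    suc (suc m) / 2   ≤⟨ /-monoˡ-≤ 2 1+m<q ⟩
    q / 2             ≡⟨ q/2≡m/2 ⟩
    m / 2             ∎)
    where open ℕₚ.≤-Reasoning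

n≤⌈m/2⌉⇒1+m≡2n : ∀ {n m} → n ≤ ⌈ m /2⌉ → m < 2 * n → suc m ≡ 2 * n
n≤⌈m/2⌉⇒1+m≡2n {n} {m} n≤⌈m/2⌉ m<2n = ℕₚ.≤-antisym m<2n (begin
  2 * n             ≡⟨ ℕₚ.*-comm 2 n ⟩
  n * 2             ≤⟨ ℕₚ.*-monoˡ-≤ 2 n≤⌈m/2⌉ ⟩
  ⌈ m /2⌉ * 2       ≤⟨ m/n*n≤m (suc m) 2 ⟩
  suc m             ∎)
  where open ℕₚ.≤-Reasoning

∣∧<⇒≡0 : ∀ {n x} → n ℕ.∣ x → x < n → x ≡ 0
∣∧<⇒≡0 {x = zero}  _   _   = refl
∣∧<⇒≡0 {x = suc x} n∣x x<n = contradiction n∣x (ℕ.>⇒∤ x<n)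

∤-positive-< : ∀ {n x} → 0 < x → x < n → ¬ n ℕ.∣ x
∤-positive-< 0<x x<n n∣x = ℕₚ.<⇒≢ 0<x (sym (∣∧<⇒≡0 n∣x x<n))

prime-∣-*-cancelʳ : ∀ {n} x {y} → Prime n → ¬ (+ n) ∣ y → (+ n) ∣ (x ℤ.* y) → (+ n) ∣ x
prime-∣-*-cancelʳ x {y} pr n∤y n∣xy with euclidsLemma ∣ x ∣ ∣ y ∣ pr (subst (_ ℕ.∣_) (ℤₚ.abs-* x y) n∣xy)
... | inj₁ n∣x = n∣x
... | inj₂ n∣y = contradiction n∣y n∤y

≡-mod-reflexive : ∀ {n x y} → x ≡ y → x ≡ y [mod n ]
≡-mod-reflexive {n} {x} refl = subst (λ z → n ℕ.∣ ∣ z ∣) (sym (ℤₚ.+-inverseʳ x)) (n ℕ.∣0)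

≡-mod-sym : ∀ {n x y} → x ≡ y [mod n ] → y ≡ x [mod n ]
≡-mod-sym {n} {x} {y} = subst (n ℕ.∣_) (ℤₚ.∣i-j∣≡∣j-i∣ x y)

≡-mod-trans : ∀ {n x y z} → x ≡ y [mod n ] → y ≡ z [mod n ] → x ≡ z [mod n ]
≡-mod-trans {n} {x} {y} {z} x≡y y≡z = Signed.∣⇒∣ᵤ (subst (Signed._∣_ (+ n)) (telescope x y z)
  (Signed.∣m∣n⇒∣m+n (Signed.∣ᵤ⇒∣ {+ n} {x ℤ.- y} x≡y) (Signed.∣ᵤ⇒∣ {+ n} {y ℤ.- z} y≡z)))
  where
  telescope : ∀ x y z → (x ℤ.- y) ℤ.+ (y ℤ.- z) ≡ x ℤ.- z
  telescope = solve-∀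

+-multiple≡-mod : ∀ n x c → (x ℤ.+ + n ℤ.* c) ≡ x [mod n ]
+-multiple≡-mod n x c = subst (λ z → n ℕ.∣ ∣ z ∣)
  (sym (add-sub x (+ n ℤ.* c))) (subst (n ℕ.∣_) (sym (ℤₚ.abs-* (+ n) c)) (ℕ.m∣m*n ∣ c ∣))
  where
  add-sub : ∀ x y → (x ℤ.+ y) ℤ.- x ≡ y
  add-sub = solve-∀

≡0-mod⇒∣ : ∀ {n x} → x ≡ 0ℤ [mod n ] → (+ n) ∣ x
≡0-mod⇒∣ {n} {x} = subst (λ z → n ℕ.∣ ∣ z ∣) (ℤₚ.+-identityʳ x)

≡-mod⇒≥ : ∀ {n a b} → (+ a) ≡ (+ b) [mod n ] → b < n → b ≤ a
≡-mod⇒≥ {n} {a} {b} a≡b b<n with ℕₚ.≤-total b a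
... | inj₁ b≤a = b≤a
... | inj₂ a≤b = ℕₚ.m∸n≡0⇒m≤n (∣∧<⇒≡0 n∣b∸a (ℕₚ.≤-<-trans (ℕₚ.m∸n≤m b a) b<n))
  where
  n∣b∸a : n ℕ.∣ (b ∸ a)
  n∣b∸a = subst (n ℕ.∣_) (trans (cong ∣_∣ (ℤₚ.m-n≡m⊖n a b)) (ℤₚ.∣⊖∣-≤ a≤b)) a≡b

≡-mod⇒≡ : ∀ {n a b} → (+ a) ≡ (+ b) [mod n ] → a < n → b < n → a ≡ b
≡-mod⇒≡ {n} {a} {b} a≡b a<n b<n =
  ℕₚ.≤-antisym (≡-mod⇒≥ {n} {b} {a} (≡-mod-sym {n} {+ a} {+ b} a≡b) a<n) (≡-mod⇒≥ {n} a≡b b<n)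

x*d+d≡[1+x]*d : ∀ x d → x ℤ.* d ℤ.+ d ≡ (1ℤ ℤ.+ x) ℤ.* d
x*d+d≡[1+x]*d = solve-∀

∣odd2k-1∣≡2k∸1 : ∀ {k} → 1 ≤ k → ∣ odd2k-1 k ∣ ≡ 2 * k ∸ 1
∣odd2k-1∣≡2k∸1 {suc k} _ = refl

1+odd2k-1≡2k : ∀ k → 1ℤ ℤ.+ odd2k-1 k ≡ + (2 * k)
1+odd2k-1≡2k k = 1+[x-1]≡x (+ (2 * k))
  where
  1+[x-1]≡x : ∀ x → 1ℤ ℤ.+ (x ℤ.- 1ℤ) ≡ x
  1+[x-1]≡x = solve-∀

_-ᵖ_ : Pair → Pair → Pair
(a , b) -ᵖ (c , d) = (a ℤ.- c , b ℤ.- d)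

+ᵖ-identityˡ : ∀ u → (0ℤ , 0ℤ) +ᵖ u ≡ u
+ᵖ-identityˡ (a , b) = cong₂ _,_ (ℤₚ.+-identityˡ a) (ℤₚ.+-identityˡ b)

+ᵖ-identityʳ : ∀ u → u +ᵖ (0ℤ , 0ℤ) ≡ u
+ᵖ-identityʳ (a , b) = cong₂ _,_ (ℤₚ.+-identityʳ a) (ℤₚ.+-identityʳ b)

+ᵖ-assoc : ∀ u v w → (u +ᵖ v) +ᵖ w ≡ u +ᵖ (v +ᵖ w)
+ᵖ-assoc (a , b) (c , d) (e , f) = cong₂ _,_ (ℤₚ.+-assoc a c e) (ℤₚ.+-assoc b d f)

[u+ᵖv]-ᵖu≡v : ∀ u v → (u +ᵖ v) -ᵖ u ≡ v
[u+ᵖv]-ᵖu≡v (a , b) (c , d) = cong₂ _,_ (cancel a c) (cancel b d)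
  where
  cancel : ∀ x y → (x ℤ.+ y) ℤ.- x ≡ y
  cancel = solve-∀

≈-reflexive : ∀ {n u v} → u ≡ v → u ≈ v [mod n ]
≈-reflexive {n} {x , y} refl = ≡-mod-reflexive {n} {x} refl , ≡-mod-reflexive {n} {y} refl

≈-sym : ∀ {n u v} → u ≈ v [mod n ] → v ≈ u [mod n ]
≈-sym {n} {x , y} {x′ , y′} (x≡ , y≡) = ≡-mod-sym {n} {x} {x′} x≡ , ≡-mod-sym {n} {y} {y′} y≡

≈-trans : ∀ {n u v w} → u ≈ v [mod n ] → v ≈ w [mod n ] → u ≈ w [mod n ]
≈-trans {n} {x , y} {x′ , y′} {x″ , y″} (x≡ , y≡) (x≡′ , y≡′) =
  ≡-mod-trans {n} {x} {x′} {x″} x≡ x≡′ , ≡-mod-trans {n} {y} {y′} {y″} y≡ y≡′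

+ᵖ-multiple≈ : ∀ n u c → (u +ᵖ (+ n ℤ.* c , + n ℤ.* c)) ≈ u [mod n ]
+ᵖ-multiple≈ n (x , y) c = +-multiple≡-mod n x c , +-multiple≡-mod n y c

windowSum : (ℕ → Pair) → ℕ → ℕ → Pair
windowSum f g zero    = (0ℤ , 0ℤ)
windowSum f g (suc l) = f g +ᵖ windowSum f (suc g) l

prefixSum : (ℕ → Pair) → ℕ → Pair
prefixSum f = windowSum f 1

sumᵖ-applyUpTo : ∀ f {h : ℕ → Pair} p l → (∀ i → h i ≡ f (p + i)) →
                 sumᵖ (applyUpTo h l) ≡ windowSum f p l
sumᵖ-applyUpTo f p zero    h≗f = refl
sumᵖ-applyUpTo f p (suc l) h≗f = cong₂ _+ᵖ_
  (trans (h≗f 0) (cong f (ℕₚ.+-identityʳ p)))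
  (sumᵖ-applyUpTo f (suc p) l (λ i → trans (h≗f (suc i)) (cong f (ℕₚ.+-suc p i))))

sumᵖ-map-range : ∀ f p q → sumᵖ (map f (range p q)) ≡ windowSum f p (suc q ∸ p)
sumᵖ-map-range f p q = trans
  (cong sumᵖ (trans (cong (map f) (map-applyUpTo _ (λ i → p + i) l)) (map-applyUpTo _ f l)))
  (sumᵖ-applyUpTo f p l (λ _ → refl))
  where l = suc q ∸ p

windowSum-+ : ∀ f g l l′ → windowSum f g (l + l′) ≡ windowSum f g l +ᵖ windowSum f (g + l) l′
windowSum-+ f g zero    l′ =
  sym (trans (+ᵖ-identityˡ _) (cong (λ g′ → windowSum f g′ l′) (ℕₚ.+-identityʳ g)))
windowSum-+ f g (suc l) l′ = begin
  f g +ᵖ windowSum f (suc g) (l + l′)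
    ≡⟨ cong (f g +ᵖ_) (windowSum-+ f (suc g) l l′) ⟩
  f g +ᵖ (windowSum f (suc g) l +ᵖ windowSum f (suc g + l) l′)
    ≡⟨ sym (+ᵖ-assoc (f g) _ _) ⟩
  windowSum f g (suc l) +ᵖ windowSum f (suc g + l) l′
    ≡⟨ cong (λ g′ → windowSum f g (suc l) +ᵖ windowSum f g′ l′) (sym (ℕₚ.+-suc g l)) ⟩
  windowSum f g (suc l) +ᵖ windowSum f (g + suc l) l′ ∎
  where open ≡-Reasoning

prefixSum-suc : ∀ f q → prefixSum f (suc q) ≡ prefixSum f q +ᵖ f (suc q)
prefixSum-suc f q = begin
  prefixSum f (suc q)                          ≡⟨ cong (prefixSum f) (ℕₚ.+-comm 1 q) ⟩
  prefixSum f (q + 1)                          ≡⟨ windowSum-+ f 1 q 1 ⟩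
  prefixSum f q +ᵖ (f (suc q) +ᵖ (0ℤ , 0ℤ))    ≡⟨ cong (prefixSum f q +ᵖ_) (+ᵖ-identityʳ (f (suc q))) ⟩
  prefixSum f q +ᵖ f (suc q)                   ∎
  where open ≡-Reasoning

sumᵖ-map-range≡prefixSum-ᵖprefixSum : ∀ f {m q} → m ≤ q →
  sumᵖ (map f (range (suc m) q)) ≡ prefixSum f q -ᵖ prefixSum f m
sumᵖ-map-range≡prefixSum-ᵖprefixSum f {m} {q} m≤q = begin
  sumᵖ (map f (range (suc m) q))                         ≡⟨ sumᵖ-map-range f (suc m) q ⟩
  windowSum f (suc m) (q ∸ m)                            ≡⟨ sym ([u+ᵖv]-ᵖu≡v (prefixSum f m) _) ⟩
  (prefixSum f m +ᵖ windowSum f (suc m) (q ∸ m)) -ᵖ prefixSum f m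
    ≡⟨ cong (_-ᵖ prefixSum f m) (sym (windowSum-+ f 1 m (q ∸ m))) ⟩
  prefixSum f (m + (q ∸ m)) -ᵖ prefixSum f m             ≡⟨ cong (λ r → prefixSum f r -ᵖ prefixSum f m) (ℕₚ.m+[n∸m]≡n m≤q) ⟩
  prefixSum f q -ᵖ prefixSum f m                         ∎
  where open ≡-Reasoning

module _ (n k : ℕ) where

  private
    d : ℤ
    d = odd2k-1 k

  alternating : ℕ → Pair
  alternating g = if g % 2 ≡ᵇ 1 then (0ℤ , d) else (d , 0ℤ)

  alternating-+ᵖ-suc : ∀ g → alternating g +ᵖ alternating (suc g) ≡ (d , d)
  alternating-+ᵖ-suc zero          = cong₂ _,_ (ℤₚ.+-identityʳ d) (ℤₚ.+-identityˡ d)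
  alternating-+ᵖ-suc (suc zero)    = cong₂ _,_ (ℤₚ.+-identityˡ d) (ℤₚ.+-identityʳ d)
  alternating-+ᵖ-suc (suc (suc g)) = alternating-+ᵖ-suc g

  a-below : ∀ {g} → g ≢ 2 * n → a n k g ≡ alternating g
  a-below g≢2n rewrite ≢⇒≡ᵇ≡false g≢2n = refl

  a-top : a n k (2 * n) ≡ (+ (2 * k) , 0ℤ)
  a-top rewrite ≡ᵇ-refl (2 * n) = refl

  a-+ᵖ-a-suc : ∀ g → suc g < 2 * n → a n k g +ᵖ a n k (suc g) ≡ (d , d)
  a-+ᵖ-a-suc g 1+g<2n = begin
    a n k g +ᵖ a n k (suc g)             ≡⟨ cong₂ _+ᵖ_ (a-below (ℕₚ.<⇒≢ (ℕₚ.<-trans (ℕₚ.n<1+n g) 1+g<2n)))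
                                                        (a-below (ℕₚ.<⇒≢ 1+g<2n)) ⟩
    alternating g +ᵖ alternating (suc g) ≡⟨ alternating-+ᵖ-suc g ⟩
    (d , d)                              ∎
    where open ≡-Reasoning

  prefixSum-below : ∀ q → q < 2 * n → prefixSum (a n k) q ≡ (+ ⌊ q /2⌋ ℤ.* d , + ⌈ q /2⌉ ℤ.* d)
  prefixSum-below zero          _    = refl
  prefixSum-below (suc zero)    1<2n = begin
    a n k 1 +ᵖ (0ℤ , 0ℤ)  ≡⟨ +ᵖ-identityʳ (a n k 1) ⟩
    a n k 1               ≡⟨ a-below (ℕₚ.<⇒≢ 1<2n) ⟩
    (0ℤ , d)              ≡⟨ cong (0ℤ ,_) (sym (ℤₚ.*-identityˡ d)) ⟩
    (+ 0 ℤ.* d , + 1 ℤ.* d) ∎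
    where open ≡-Reasoning
  prefixSum-below (suc (suc q)) 2+q<2n = begin
    prefixSum (a n k) (suc (suc q))
      ≡⟨ prefixSum-suc (a n k) (suc q) ⟩
    prefixSum (a n k) (suc q) +ᵖ a n k (suc (suc q))
      ≡⟨ cong (_+ᵖ a n k (suc (suc q))) (prefixSum-suc (a n k) q) ⟩
    (prefixSum (a n k) q +ᵖ a n k (suc q)) +ᵖ a n k (suc (suc q))
      ≡⟨ +ᵖ-assoc (prefixSum (a n k) q) _ _ ⟩
    prefixSum (a n k) q +ᵖ (a n k (suc q) +ᵖ a n k (suc (suc q)))
      ≡⟨ cong₂ _+ᵖ_ (prefixSum-below q (ℕₚ.<-trans (ℕₚ.n<1+n q) (ℕₚ.<-trans (ℕₚ.n<1+n (suc q)) 2+q<2n)))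
                    (a-+ᵖ-a-suc (suc q) 2+q<2n) ⟩
    (+ (q / 2) ℤ.* d , + (suc q / 2) ℤ.* d) +ᵖ (d , d)
      ≡⟨ cong₂ _,_ (x*d+d≡[1+x]*d (+ (q / 2)) d) (x*d+d≡[1+x]*d (+ (suc q / 2)) d) ⟩
    (+ suc (q / 2) ℤ.* d , + suc (suc q / 2) ℤ.* d)
      ≡⟨ sym (cong₂ (λ x y → (+ x ℤ.* d , + y ℤ.* d)) ([2+m]/2≡1+m/2 q) ([2+m]/2≡1+m/2 (suc q))) ⟩
    (+ (suc (suc q) / 2) ℤ.* d , + (suc (suc (suc q)) / 2) ℤ.* d) ∎
    where open ≡-Reasoning

prefixSum-top : ∀ m k → prefixSum (a (suc m) k) (2 * suc m) ≡
                (1ℤ ℤ.+ + suc m ℤ.* odd2k-1 k , + suc m ℤ.* odd2k-1 k)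
prefixSum-top m k = begin
  prefixSum (a n k) (2 * n)
    ≡⟨ cong (prefixSum (a n k)) 2n≡2+2m ⟩
  prefixSum (a n k) (suc (suc (m * 2)))
    ≡⟨ prefixSum-suc (a n k) (suc (m * 2)) ⟩
  prefixSum (a n k) (suc (m * 2)) +ᵖ a n k (suc (suc (m * 2)))
    ≡⟨ cong₂ _+ᵖ_ (prefixSum-below n k (suc (m * 2)) (subst (suc (m * 2) <_) (sym 2n≡2+2m) (ℕₚ.n<1+n _)))
                  (trans (cong (a n k) (sym 2n≡2+2m)) (a-top n k)) ⟩
  (+ (suc (m * 2) / 2) ℤ.* d , + (n * 2 / 2) ℤ.* d) +ᵖ (+ (2 * k) , 0ℤ)
    ≡⟨ cong₂ (λ x y → (+ x ℤ.* d , + y ℤ.* d) +ᵖ (+ (2 * k) , 0ℤ)) ([1+m*2]/2≡m m) (m*n/n≡m n 2) ⟩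
  (+ m ℤ.* d ℤ.+ + (2 * k) , + n ℤ.* d ℤ.+ 0ℤ)
    ≡⟨ cong₂ _,_ (top-entry (+ m) (+ (2 * k))) (ℤₚ.+-identityʳ (+ n ℤ.* d)) ⟩
  (1ℤ ℤ.+ + n ℤ.* d , + n ℤ.* d) ∎
  where
  open ≡-Reasoning
  n = suc m
  d = odd2k-1 k
  2n≡2+2m : 2 * n ≡ suc (suc (m * 2))
  2n≡2+2m = ℕₚ.*-comm 2 n
  top-entry : ∀ x y → x ℤ.* (y ℤ.- 1ℤ) ℤ.+ y ≡ 1ℤ ℤ.+ (1ℤ ℤ.+ x) ℤ.* (y ℤ.- 1ℤ)
  top-entry = solve-∀

formula-below : ∀ n k p {q} → q ≢ 2 * n → formula n k p q ≡
  ((+ ⌊ q /2⌋ ℤ.- + ⌊ p ∸ 1 /2⌋) ℤ.* odd2k-1 k , (+ ⌈ q /2⌉ ℤ.- + ⌈ p ∸ 1 /2⌉) ℤ.* odd2k-1 k)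
formula-below n k p q≢2n rewrite ≢⇒≡ᵇ≡false q≢2n = refl

formula-top : ∀ n k p → formula n k p (2 * n) ≡
  (1ℤ ℤ.- + ⌊ p ∸ 1 /2⌋ ℤ.* odd2k-1 k , ℤ.- (+ ⌈ p ∸ 1 /2⌉ ℤ.* odd2k-1 k))
formula-top n k p rewrite ≡ᵇ-refl (2 * n) = refl

partialStretch-sum-below : ∀ n k {m q} → m < q → q < 2 * n →
  sumᵖ (partialStretch n k (suc m) q) ≡ formula n k (suc m) q
partialStretch-sum-below n k {m} {q} m<q q<2n = begin
  sumᵖ (partialStretch n k (suc m) q)
    ≡⟨ sumᵖ-map-range≡prefixSum-ᵖprefixSum (a n k) (ℕₚ.<⇒≤ m<q) ⟩
  prefixSum (a n k) q -ᵖ prefixSum (a n k) m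
    ≡⟨ cong₂ _-ᵖ_ (prefixSum-below n k q q<2n) (prefixSum-below n k m (ℕₚ.<-trans m<q q<2n)) ⟩
  (+ ⌊ q /2⌋ ℤ.* d , + ⌈ q /2⌉ ℤ.* d) -ᵖ (+ ⌊ m /2⌋ ℤ.* d , + ⌈ m /2⌉ ℤ.* d)
    ≡⟨ cong₂ _,_ (x*d-y*d≡[x-y]*d (+ ⌊ q /2⌋) (+ ⌊ m /2⌋) d) (x*d-y*d≡[x-y]*d (+ ⌈ q /2⌉) (+ ⌈ m /2⌉) d) ⟩
  ((+ ⌊ q /2⌋ ℤ.- + ⌊ m /2⌋) ℤ.* d , (+ ⌈ q /2⌉ ℤ.- + ⌈ m /2⌉) ℤ.* d)
    ≡⟨ sym (formula-below n k (suc m) (ℕₚ.<⇒≢ q<2n)) ⟩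
  formula n k (suc m) q ∎
  where
  open ≡-Reasoning
  d = odd2k-1 k
  x*d-y*d≡[x-y]*d : ∀ x y d → x ℤ.* d ℤ.- y ℤ.* d ≡ (x ℤ.- y) ℤ.* d
  x*d-y*d≡[x-y]*d = solve-∀

partialStretch-sum-top : ∀ n k {m} → m < 2 * suc n →
  sumᵖ (partialStretch (suc n) k (suc m) (2 * suc n)) ≡
  formula (suc n) k (suc m) (2 * suc n) +ᵖ (+ suc n ℤ.* odd2k-1 k , + suc n ℤ.* odd2k-1 k)
partialStretch-sum-top n k {m} m<2N = begin
  sumᵖ (partialStretch N k (suc m) (2 * N))
    ≡⟨ sumᵖ-map-range≡prefixSum-ᵖprefixSum (a N k) (ℕₚ.<⇒≤ m<2N) ⟩
  prefixSum (a N k) (2 * N) -ᵖ prefixSum (a N k) m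
    ≡⟨ cong₂ _-ᵖ_ (prefixSum-top n k) (prefixSum-below N k m m<2N) ⟩
  (1ℤ ℤ.+ + N ℤ.* d , + N ℤ.* d) -ᵖ (+ ⌊ m /2⌋ ℤ.* d , + ⌈ m /2⌉ ℤ.* d)
    ≡⟨ cong₂ _,_ (first (+ N ℤ.* d) (+ ⌊ m /2⌋ ℤ.* d)) (second (+ N ℤ.* d) (+ ⌈ m /2⌉ ℤ.* d)) ⟩
  (1ℤ ℤ.- + ⌊ m /2⌋ ℤ.* d , ℤ.- (+ ⌈ m /2⌉ ℤ.* d)) +ᵖ (+ N ℤ.* d , + N ℤ.* d)
    ≡⟨ cong (_+ᵖ (+ N ℤ.* d , + N ℤ.* d)) (sym (formula-top N k (suc m))) ⟩
  formula N k (suc m) (2 * N) +ᵖ (+ N ℤ.* d , + N ℤ.* d) ∎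
  where
  open ≡-Reasoning
  N = suc n
  d = odd2k-1 k
  first : ∀ x y → (1ℤ ℤ.+ x) ℤ.- y ≡ (1ℤ ℤ.- y) ℤ.+ x
  first = solve-∀
  second : ∀ x y → x ℤ.- y ≡ ℤ.- y ℤ.+ x
  second = solve-∀

partialStretch-sum≈formula : ∀ n k {m q} → m < q → q ≤ 2 * n →
  sumᵖ (partialStretch n k (suc m) q) ≈ formula n k (suc m) q [mod n ]
partialStretch-sum≈formula zero    k () z≤n
partialStretch-sum≈formula (suc n) k {m} {q} m<q q≤2N with q ≟ 2 * suc n
... | no  q≢2N = ≈-reflexive {suc n} (partialStretch-sum-below (suc n) k m<q (ℕₚ.≤∧≢⇒< q≤2N q≢2N))
... | yes refl = subst (λ s → s ≈ formula (suc n) k (suc m) q [mod suc n ])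
  (sym (partialStretch-sum-top n k m<q)) (+ᵖ-multiple≈ (suc n) (formula (suc n) k (suc m) q) (odd2k-1 k))

stretch-sum≈[1,0] : ∀ n k → 0 < n → sumᵖ (stretch n k) ≈ (1ℤ , 0ℤ) [mod n ]
stretch-sum≈[1,0] n k 0<n = subst (λ F → sumᵖ (stretch n k) ≈ F [mod n ]) (formula-top n k 1)
  (partialStretch-sum≈formula n k (ℕₚ.*-monoʳ-< 2 0<n) ℕₚ.≤-refl)

differences-below-not-both-divisible : ∀ {n m q} d → Prime n → ¬ (+ n) ∣ d → m < q → q < 2 * n →
  (+ n) ∣ ((+ ⌊ q /2⌋ ℤ.- + ⌊ m /2⌋) ℤ.* d) → ¬ (+ n) ∣ ((+ ⌈ q /2⌉ ℤ.- + ⌈ m /2⌉) ℤ.* d)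
differences-below-not-both-divisible {n} {m} {q} d pr n∤d m<q q<2n n∣⌊⌋ n∣⌈⌉ =
  n∤d (subst ((+ n) ∣_) ⌈⌉-difference≡d n∣⌈⌉)
  where
  q/2<n : q / 2 < n
  q/2<n = m<n*o⇒m/o<n (subst (q <_) (ℕₚ.*-comm 2 n) q<2n)
  q/2≡m/2 : q / 2 ≡ m / 2
  q/2≡m/2 = ≡-mod⇒≡ {n} (prime-∣-*-cancelʳ (+ (q / 2) ℤ.- + (m / 2)) pr n∤d n∣⌊⌋)
    q/2<n (ℕₚ.≤-<-trans (/-monoˡ-≤ 2 (ℕₚ.<⇒≤ m<q)) q/2<n)
  q≡1+m : q ≡ suc m
  q≡1+m = m<q∧q/2≡m/2⇒q≡1+m m<q q/2≡m/2
  [1+x-x]*d≡d : ∀ x d → (1ℤ ℤ.+ x ℤ.- x) ℤ.* d ≡ d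
  [1+x-x]*d≡d = solve-∀
  ⌈⌉-difference≡d : (+ ⌈ q /2⌉ ℤ.- + ⌈ m /2⌉) ℤ.* d ≡ d
  ⌈⌉-difference≡d = begin
    (+ (suc q / 2) ℤ.- + (suc m / 2)) ℤ.* d
      ≡⟨ cong₂ (λ x y → (+ x ℤ.- + y) ℤ.* d)
               (trans (cong (λ r → suc r / 2) q≡1+m) ([2+m]/2≡1+m/2 m))
               (trans (cong (_/ 2) (sym q≡1+m)) q/2≡m/2) ⟩
    (1ℤ ℤ.+ + (m / 2) ℤ.- + (m / 2)) ℤ.* d
      ≡⟨ [1+x-x]*d≡d (+ (m / 2)) d ⟩
    d ∎
    where open ≡-Reasoning

differences-top-not-both-divisible : ∀ {n m} d → Prime n → ¬ (+ n) ∣ d → ¬ (+ n) ∣ (1ℤ ℤ.+ d) → m < 2 * n →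
  (+ n) ∣ (1ℤ ℤ.- + ⌊ m /2⌋ ℤ.* d) → ¬ (+ n) ∣ (ℤ.- (+ ⌈ m /2⌉ ℤ.* d))
differences-top-not-both-divisible {n} {zero} d pr _ _ _ n∣1 _ = ¬prime[1] (subst Prime (ℕ.∣1⇒≡1 n∣1) pr)
differences-top-not-both-divisible {zero}  {suc m} d _ _ _ ()
differences-top-not-both-divisible {suc n} {suc m} d pr n∤d n∤1+d m<2N n∣first n∣second = n∤1+d N∣1+d
  where
  N = suc n
  ⌈m/2⌉≡1+⌊m/2⌋ : ⌈ suc m /2⌉ ≡ suc (m / 2)
  ⌈m/2⌉≡1+⌊m/2⌋ = [2+m]/2≡1+m/2 m
  N∣⌈m/2⌉ : N ℕ.∣ ⌈ suc m /2⌉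
  N∣⌈m/2⌉ = prime-∣-*-cancelʳ (+ ⌈ suc m /2⌉) pr n∤d (subst (N ℕ.∣_) (ℤₚ.∣-i∣≡∣i∣ (+ ⌈ suc m /2⌉ ℤ.* d)) n∣second)
  N≤⌈m/2⌉ : N ≤ ⌈ suc m /2⌉
  N≤⌈m/2⌉ = subst (N ≤_) (sym ⌈m/2⌉≡1+⌊m/2⌋) (ℕ.∣⇒≤ (subst (N ℕ.∣_) ⌈m/2⌉≡1+⌊m/2⌋ N∣⌈m/2⌉))
  m≡1+n*2 : suc m ≡ suc (n * 2)
  m≡1+n*2 = ℕₚ.suc-injective (trans (n≤⌈m/2⌉⇒1+m≡2n N≤⌈m/2⌉ m<2N) (ℕₚ.*-comm 2 N))
  ⌊m/2⌋≡n : ⌊ suc m /2⌋ ≡ n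
  ⌊m/2⌋≡n = trans (cong (_/ 2) m≡1+n*2) ([1+m*2]/2≡m n)
  N∣1-nd : (+ N) ∣ (1ℤ ℤ.- + n ℤ.* d)
  N∣1-nd = subst (λ x → (+ N) ∣ (1ℤ ℤ.- + x ℤ.* d)) ⌊m/2⌋≡n n∣first
  [1-nd]+Nd≡1+d : ∀ n d → (1ℤ ℤ.- n ℤ.* d) ℤ.+ (1ℤ ℤ.+ n) ℤ.* d ≡ 1ℤ ℤ.+ d
  [1-nd]+Nd≡1+d = solve-∀
  N∣1+d : (+ N) ∣ (1ℤ ℤ.+ d)
  N∣1+d = Signed.∣⇒∣ᵤ (subst (Signed._∣_ (+ N)) ([1-nd]+Nd≡1+d (+ n) d)
    (Signed.∣m∣n⇒∣m+n (Signed.∣ᵤ⇒∣ {+ N} {1ℤ ℤ.- + n ℤ.* d} N∣1-nd) (Signed.∣m⇒∣m*n d Signed.∣-refl)))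

formula≉0 : ∀ n k {m q} → Prime n → ¬ (+ n) ∣ odd2k-1 k → ¬ (+ n) ∣ (1ℤ ℤ.+ odd2k-1 k) →
  m < q → q ≤ 2 * n → ¬ (formula n k (suc m) q ≈ (0ℤ , 0ℤ) [mod n ])
formula≉0 n k {m} {q} pr n∤d n∤1+d m<q q≤2n with q ≟ 2 * n
... | no q≢2n = λ formula≈0 →
  let (f₁≈0 , f₂≈0) = subst (λ F → F ≈ (0ℤ , 0ℤ) [mod n ]) (formula-below n k (suc m) q≢2n) formula≈0
  in differences-below-not-both-divisible (odd2k-1 k) pr n∤d m<q (ℕₚ.≤∧≢⇒< q≤2n q≢2n)
       (≡0-mod⇒∣ {n} {(+ ⌊ q /2⌋ ℤ.- + ⌊ m /2⌋) ℤ.* odd2k-1 k} f₁≈0)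
       (≡0-mod⇒∣ {n} {(+ ⌈ q /2⌉ ℤ.- + ⌈ m /2⌉) ℤ.* odd2k-1 k} f₂≈0)
... | yes refl = λ formula≈0 →
  let (f₁≈0 , f₂≈0) = subst (λ F → F ≈ (0ℤ , 0ℤ) [mod n ]) (formula-top n k (suc m)) formula≈0
  in differences-top-not-both-divisible (odd2k-1 k) pr n∤d n∤1+d m<q
       (≡0-mod⇒∣ {n} {1ℤ ℤ.- + ⌊ m /2⌋ ℤ.* odd2k-1 k} f₁≈0)
       (≡0-mod⇒∣ {n} {ℤ.- (+ ⌈ m /2⌉ ℤ.* odd2k-1 k)} f₂≈0)

partialStretch-sum≉0 : ∀ n k {m q} → Prime n → ¬ (+ n) ∣ odd2k-1 k → ¬ (+ n) ∣ (1ℤ ℤ.+ odd2k-1 k) →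
  m < q → q ≤ 2 * n → ¬ (sumᵖ (partialStretch n k (suc m) q) ≈ (0ℤ , 0ℤ) [mod n ])
partialStretch-sum≉0 n k {m} {q} pr n∤d n∤1+d m<q q≤2n sum≈0 = formula≉0 n k pr n∤d n∤1+d m<q q≤2n
  (≈-trans {n} {formula n k (suc m) q} {sumᵖ (partialStretch n k (suc m) q)} {0ℤ , 0ℤ}
    (≈-sym {n} {sumᵖ (partialStretch n k (suc m) q)} (partialStretch-sum≈formula n k m<q q≤2n)) sum≈0)

lemma12 : (n : ℕ) → Prime n → n % 2 ≡ 1 →
    (k : ℕ) → 1 ≤ k → k ≤ (n ∸ 1) / 2 →
    ((p q : ℕ) → 1 ≤ p → p ≤ q → q ≤ 2 * n →
    sumᵖ (partialStretch n k p q) ≈ formula n k p q [mod n ])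
    × (sumᵖ (stretch n k) ≈ (1ℤ , 0ℤ) [mod n ])
    × ((p q : ℕ) → 1 ≤ p → p ≤ q → q ≤ 2 * n →
    ¬ (sumᵖ (partialStretch n k p q) ≈ (0ℤ , 0ℤ) [mod n ]))
lemma12 zero    _  ()
lemma12 (suc n) pr _ k 1≤k k≤n/2 = sum≈formula , stretch-sum≈[1,0] N k (s≤s z≤n) , sum≉0
  where
  N = suc n
  2k<N : 2 * k < N
  2k<N = s≤s (begin
    2 * k        ≤⟨ ℕₚ.*-monoʳ-≤ 2 k≤n/2 ⟩
    2 * (n / 2)  ≡⟨ ℕₚ.*-comm 2 (n / 2) ⟩
    n / 2 * 2    ≤⟨ m/n*n≤m n 2 ⟩
    n            ∎)
    where open ℕₚ.≤-Reasoning
  N∤d : ¬ (+ N) ∣ odd2k-1 k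
  N∤d = subst (λ x → ¬ N ℕ.∣ x) (sym (∣odd2k-1∣≡2k∸1 1≤k))
    (∤-positive-< (ℕₚ.m<n⇒0<n∸m (ℕₚ.*-monoʳ-≤ 2 1≤k)) (ℕₚ.≤-<-trans (ℕₚ.m∸n≤m (2 * k) 1) 2k<N))
  N∤1+d : ¬ (+ N) ∣ (1ℤ ℤ.+ odd2k-1 k)
  N∤1+d = subst (λ x → ¬ (+ N) ∣ x) (sym (1+odd2k-1≡2k k))
    (∤-positive-< (ℕₚ.*-monoʳ-< 2 1≤k) 2k<N)
  sum≈formula : (p q : ℕ) → 1 ≤ p → p ≤ q → q ≤ 2 * N →
    sumᵖ (partialStretch N k p q) ≈ formula N k p q [mod N ]
  sum≈formula (suc m) q _ m<q q≤2N = partialStretch-sum≈formula N k m<q q≤2N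
  sum≉0 : (p q : ℕ) → 1 ≤ p → p ≤ q → q ≤ 2 * N →
    ¬ (sumᵖ (partialStretch N k p q) ≈ (0ℤ , 0ℤ) [mod N ])
  sum≉0 (suc m) q _ m<q q≤2N = partialStretch-sum≉0 N k pr N∤d N∤1+d m<q q≤2N
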